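{- Let $\mathbf{P}=(X,P)$ be a poset and let $M$ be a strong module of $\mathbf{P}$. If there exists a CPT representation $\{W_x\}_{x\in X}$ of $\mathbf{P}$ in which some element of $M$ is represented by a trivial path, then no element of $M$ is greater (in $\mathbf{P}$) than any element of $X\setminus M$.
   Context: A CPT representation of a finite poset $\mathbf{P}=(X,P)$ is a tree $T$ with paths $W_x$ ($x\in X$, identified with vertex sets) such that $x<y$ iff $W_x\subsetneq W_y$. A trivial path is a single vertex. A module of $\mathbf{P}$ is a set $M\subseteq X$ such that each $y\in X\setminus M$ is comparable to all elements of $M$ or incomparable to all elements of $M$; $M$ is strong if for every module $M'$, $M\cap M'=\emptyset$, $M\subseteq M'$ or $M'\subseteq M$. -}

module Defs where

open import Level using (0ℓ)
open import Data.Nat using (ℕ; _≤_)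
open import Data.Fin using (Fin)
open import Data.Fin.Subset using (Subset; _∈_; _∉_; _⊆_; _∩_; Empty)
open import Data.List using (List; []; _∷_; _++_; length)
open import Data.List.Relation.Unary.Linked using (Linked)
open import Data.List.Relation.Unary.Unique.Propositional using (Unique)
import Data.List.Membership.Propositional as LM
open import Data.Product using (Σ; ∃; ∃-syntax; _×_)
open import Data.Sum using (_⊎_)
open import Relation.Nullary using (¬_)
open import Relation.Binary using (Rel; IsStrictPartialOrder)
open import Relation.Binary.PropositionalEquality using (_≡_)

record Poset (n : ℕ) : Set₁ where
  field
    _<_ : Rel (Fin n) 0ℓ
    isSPO : IsStrictPartialOrder _≡_ _<_

record Graph (m : ℕ) : Set₁ where
  field
    Adj : Rel (Fin m) 0ℓ
    Adj-sym : ∀ {u v} → Adj u v → Adj v u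
    Adj-irrefl : ∀ {u} → ¬ Adj u u

module _ {m : ℕ} (G : Graph m) where
  open Graph G

  Walk : Fin m → Fin m → List (Fin m) → Set
  Walk u v ys = Linked Adj (u ∷ ys) × ∃[ zs ] (u ∷ ys ≡ zs ++ (v ∷ []))

  Connected : Set
  Connected = ∀ u v → ∃[ ys ] Walk u v ys

  -- a cycle v ∷ ys (at least 3 distinct vertices, closing back to v)
  Cycle : Fin m → List (Fin m) → Set
  Cycle v ys = 2 ≤ length ys × Unique (v ∷ ys) × Linked Adj (v ∷ ys ++ (v ∷ []))

  Acyclic : Set
  Acyclic = ∀ v ys → ¬ Cycle v ys

  IsTree : Set
  IsTree = Connected × Acyclic

  IsPath : List (Fin m) → Set
  IsPath [] = Data.Empty.⊥
    where import Data.Empty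
  IsPath (v ∷ vs) = Unique (v ∷ vs) × Linked Adj (v ∷ vs)

record Tree (m : ℕ) : Set₁ where
  field
    graph : Graph m
    isTree : IsTree graph
  open Graph graph public

-- Vertex sets of paths (paths are identified with their vertex sets)

_⊆ᵥ_ : ∀ {m} → List (Fin m) → List (Fin m) → Set
p ⊆ᵥ q = ∀ v → v LM.∈ p → v LM.∈ q

_⊊ᵥ_ : ∀ {m} → List (Fin m) → List (Fin m) → Set
p ⊊ᵥ q = p ⊆ᵥ q × ∃[ v ] (v LM.∈ q × ¬ (v LM.∈ p))

Trivial : ∀ {m} → List (Fin m) → Set
Trivial p = ∃[ v ] (p ≡ v ∷ [])

record CPTRep {n : ℕ} (P : Poset n) : Set₁ where
  open Poset P
  field
    m : ℕ
    T : Tree m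
    W : Fin n → List (Fin m)
    W-path : ∀ x → IsPath (Tree.graph T) (W x)
    W-rep₁ : ∀ x y → x < y → W x ⊊ᵥ W y
    W-rep₂ : ∀ x y → W x ⊊ᵥ W y → x < y

module _ {n : ℕ} (P : Poset n) where
  open Poset P

  Comparable : Fin n → Fin n → Set
  Comparable x y = x < y ⊎ y < x

  IsModule : Subset n → Set
  IsModule M = ∀ y → y ∉ M →
    (∀ a → a ∈ M → Comparable y a) ⊎ (∀ a → a ∈ M → ¬ Comparable y a)

  IsStrongModule : Subset n → Set
  IsStrongModule M = IsModule M ×
    (∀ M′ → IsModule M′ → Empty (M ∩ M′) ⊎ M ⊆ M′ ⊎ M′ ⊆ M)

{-# OPTIONS --safe #-}
module Submission where

open import Level using (0ℓ)
open import Defs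
open import Data.Nat using (ℕ)
open import Data.Fin using (Fin; zero; suc)
open import Data.Fin.Subset using (Subset; _∈_; _∉_)
open import Data.Fin.Subset.Properties using (_∈?_; x∈p∩q⁺)
open import Data.Fin.Properties using (all?; ¬∀⟶∃¬)
open import Data.Product using (∃-syntax; _×_; _,_)
open import Data.Sum using (inj₁; inj₂)
open import Data.Bool using (true)
open import Data.Empty using (⊥-elim)
open import Data.List using (List; _∷_)
open import Data.List.Relation.Unary.Any using (here)
open import Data.Vec using (tabulate)
open import Data.Vec.Properties using (lookup∘tabulate; []=⇒lookup; lookup⇒[]=)
open import Function using (_∘_; case_of_)
open import Relation.Nullary using (¬_; Dec; yes; no; does)
open import Relation.Nullary.Decidable using (_→-dec_; dec-true)
open import Relation.Nullary.Decidable.Core using (¬¬-excluded-middle)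
open import Relation.Binary using (IsStrictPartialOrder; Decidable)
open import Relation.Binary.PropositionalEquality using (_≡_; refl; sym; trans)
open import Relation.Unary as U using (Pred)

-- A trivial path W x makes x minimal in P, since no nonempty path is properly contained in a single
-- vertex. If some b ∉ M lay below a ∈ M, then b is comparable to all of M, so x < b. The set L of
-- common lower bounds of {m ∈ M | b < m} turns out to be a module; it contains x ∈ M and b ∉ M but
-- not a ∈ M, so it overlaps M without being comparable to it under inclusion, and M is not strong.
-- Forming L as a subset requires deciding _<_, which is harmless because the goal is a negation.

¬¬-∀-Fin : ∀ {n} {Q : Fin n → Set} → (∀ i → ¬ ¬ Q i) → ¬ ¬ (∀ i → Q i)
¬¬-∀-Fin {ℕ.zero}  ¬¬Q ¬∀Q = ¬∀Q λ ()
¬¬-∀-Fin {ℕ.suc n} ¬¬Q ¬∀Q =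
  ¬¬Q zero λ Q₀ → ¬¬-∀-Fin (λ i → ¬¬Q (suc i)) λ Qₛ →
    ¬∀Q λ { zero → Q₀ ; (suc i) → Qₛ i }

¬¬-decidable : ∀ {n} {_~_ : Fin n → Fin n → Set} → ¬ ¬ Decidable _~_
¬¬-decidable = ¬¬-∀-Fin λ _ → ¬¬-∀-Fin λ _ → ¬¬-excluded-middle

module _ {n : ℕ} {Q : Pred (Fin n) 0ℓ} (Q? : U.Decidable Q) where

  fromDecidable : Subset n
  fromDecidable = tabulate λ i → does (Q? i)

  ∈-fromDecidable⁺ : ∀ {i} → Q i → i ∈ fromDecidable
  ∈-fromDecidable⁺ {i} q =
    lookup⇒[]= i fromDecidable (trans (lookup∘tabulate _ i) (dec-true (Q? i) q))

  ∈-fromDecidable⁻ : ∀ {i} → i ∈ fromDecidable → Q i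
  ∈-fromDecidable⁻ {i} i∈ = witness (Q? i) (trans (sym (lookup∘tabulate _ i)) ([]=⇒lookup i∈))
    where
    witness : (d : Dec (Q i)) → does d ≡ true → Q i
    witness (yes q) _ = q
    witness (no _) ()

⊊ᵥ-trivial : ∀ {m} {u : Fin m} {us q : List (Fin m)} → Trivial q → ¬ (u ∷ us) ⊊ᵥ q
⊊ᵥ-trivial (v , refl) (sub , w , here refl , w∉) with sub _ (here refl)
... | here refl = w∉ (here refl)

module _ {n : ℕ} {P : Poset n} (R : CPTRep P) where
  open Poset P
  open CPTRep R

  trivial⇒minimal : ∀ {x} → Trivial (W x) → ∀ w → ¬ w < x
  trivial⇒minimal Wx w w<x with W w | W-path w | W-rep₁ w _ w<x
  ... | u ∷ us | _ | W⊊ = ⊊ᵥ-trivial Wx W⊊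

module _ {n : ℕ} (P : Poset n) where
  open Poset P

  comparable⇒comparable-to-all : ∀ {M y a} → IsModule P M → y ∉ M → a ∈ M →
    Comparable P y a → ∀ m → m ∈ M → Comparable P y m
  comparable⇒comparable-to-all M-module y∉M a∈M y~a with M-module _ y∉M
  ... | inj₁ all-comparable = all-comparable
  ... | inj₂ none-comparable = ⊥-elim (none-comparable _ a∈M y~a)

module CommonLowerBounds
  {n : ℕ} (P : Poset n) (_<?_ : Decidable (Poset._<_ P))
  {M : Subset n} (M-module : IsModule P M)
  {x : Fin n} (x∈M : x ∈ M) (x-minimal : ∀ w → ¬ Poset._<_ P w x)
  {a b : Fin n} (a∈M : a ∈ M) (b∉M : b ∉ M) (b<a : Poset._<_ P b a)
  where

  open Poset P
  open IsStrictPartialOrder isSPO using (irrefl) renaming (trans to <-trans)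

  Bounds : Fin n → Fin n → Set
  Bounds y m = m ∈ M → b < m → y < m

  bounds? : Decidable Bounds
  bounds? y m = (m ∈? M) →-dec (b <? m) →-dec (y <? m)

  LowerBound : Pred (Fin n) 0ℓ
  LowerBound y = ∀ m → Bounds y m

  LowerBound? : U.Decidable LowerBound
  LowerBound? y = all? (bounds? y)

  L : Subset n
  L = fromDecidable LowerBound?

  comparable-to-M : ∀ {y} → y ∉ M → ∀ {a′} → a′ ∈ M → y < a′ → ∀ m → m ∈ M → Comparable P y m
  comparable-to-M y∉M a′∈M y<a′ = comparable⇒comparable-to-all P M-module y∉M a′∈M (inj₁ y<a′)

  x<b : x < b
  x<b with comparable-to-M b∉M a∈M b<a x x∈M
  ... | inj₁ b<x = ⊥-elim (x-minimal b b<x)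
  ... | inj₂ x<b = x<b

  x∈L : x ∈ L
  x∈L = ∈-fromDecidable⁺ LowerBound? λ _ _ b<m → <-trans x<b b<m

  b∈L : b ∈ L
  b∈L = ∈-fromDecidable⁺ LowerBound? λ _ _ b<m → b<m

  L<a : ∀ {w} → w ∈ L → w < a
  L<a w∈L = ∈-fromDecidable⁻ LowerBound? w∈L a a∈M b<a

  a∉L : a ∉ L
  a∉L a∈L = irrefl refl (L<a a∈L)

  ∉L⇒witness : ∀ {z} → z ∉ L → ∃[ m ] (m ∈ M × b < m × ¬ z < m)
  ∉L⇒witness {z} z∉L
    with ¬∀⟶∃¬ n _ (bounds? z) (z∉L ∘ ∈-fromDecidable⁺ LowerBound?)
  ... | m , ¬bound with m ∈? M | b <? m | z <? m
  ... | yes m∈M | yes b<m | no z≮m = m , m∈M , b<m , z≮m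
  ... | no m∉M  | _       | _       = ⊥-elim (¬bound λ m∈M → ⊥-elim (m∉M m∈M))
  ... | yes _   | no b≮m  | _       = ⊥-elim (¬bound λ _ b<m → ⊥-elim (b≮m b<m))
  ... | yes _   | yes _   | yes z<m = ⊥-elim (¬bound λ _ _ → z<m)

  -- If z ∉ M is incomparable to M, then any w ∈ L below z would be comparable to M (as w < a),
  -- hence lie above the minimal element x, making z comparable to x.
  incomparable-to-M⇒incomparable-to-L : ∀ {z} → z ∉ M → (∀ m → m ∈ M → ¬ Comparable P z m) →
    ∀ w → w ∈ L → ¬ Comparable P z w
  incomparable-to-M⇒incomparable-to-L z∉M z≁M w w∈L (inj₁ z<w) = z≁M a a∈M (inj₁ (<-trans z<w (L<a w∈L)))
  incomparable-to-M⇒incomparable-to-L z∉M z≁M w w∈L (inj₂ w<z) with w ∈? M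
  ... | yes w∈M = z≁M w w∈M (inj₂ w<z)
  ... | no w∉M with comparable-to-M w∉M a∈M (L<a w∈L) x x∈M
  ...   | inj₁ w<x = x-minimal w w<x
  ...   | inj₂ x<w = z≁M x x∈M (inj₂ (<-trans x<w w<z))

  L-isModule : IsModule P L
  L-isModule z z∉L with ∉L⇒witness z∉L
  ... | m , m∈M , b<m , z≮m with z ∈? M
  ...   | yes z∈M = inj₁ λ w w∈L → inj₂ (∈-fromDecidable⁻ LowerBound? w∈L z z∈M b<z)
    where
    b<z : b < z
    b<z with comparable-to-M b∉M a∈M b<a z z∈M
    ... | inj₁ b<z = b<z
    ... | inj₂ z<b = ⊥-elim (z≮m (<-trans z<b b<m))
  ...   | no z∉M with M-module z z∉M
  ...     | inj₂ z≁M = inj₂ (incomparable-to-M⇒incomparable-to-L z∉M z≁M)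
  ...     | inj₁ z~M with z~M m m∈M
  ...       | inj₁ z<m = ⊥-elim (z≮m z<m)
  ...       | inj₂ m<z = inj₁ λ w w∈L → inj₂ (<-trans (∈-fromDecidable⁻ LowerBound? w∈L m m∈M b<m) m<z)

lemma2 : ∀ {n : ℕ} (P : Poset n) (M : Subset n) → IsStrongModule P M →
    (∃[ R ] ∃[ x ] (x ∈ M × Trivial (CPTRep.W {P = P} R x))) →
    ∀ a b → a ∈ M → b ∉ M → ¬ Poset._<_ P b a
lemma2 P M (M-module , M-strong) (R , x , x∈M , Wx-trivial) a b a∈M b∉M b<a =
  ¬¬-decidable λ _<?_ →
    let open CommonLowerBounds P _<?_ M-module x∈M (trivial⇒minimal R Wx-trivial) a∈M b∉M b<a
    in case M-strong L L-isModule of λ where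
         (inj₁ M∩L-empty)   → M∩L-empty (x , x∈p∩q⁺ (x∈M , x∈L))
         (inj₂ (inj₁ M⊆L)) → a∉L (M⊆L a∈M)
         (inj₂ (inj₂ L⊆M)) → b∉M (L⊆M b∈L)
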